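{- Let $n\geq 1$, $S,T\subseteq[n-1]$, and write $T=\{i_1<\cdots<i_k\}$. Let $N_T$ be the multiset $\{1^{i_1},2^{i_2-i_1},\dots,(k+1)^{n-i_k}\}$ and $\mathfrak{S}_{N_T}$ the set of all permutations (words) $w=a_1\cdots a_n$ of $N_T$. Then $$\#\{w\in\mathfrak{S}_{N_T} : C(w)=S\}=(\Gamma M)_{\overline{S}\,\overline{T}}=\sum_{U\supseteq\overline{T}}\Gamma_{\overline{S}U}=\#\{w\in\mathfrak{S}_n : C(w)=S,\ D(w)\supseteq\overline{T}\}.$$
   Context: $[n]=\{1,\dots,n\}$, $\mathfrak{S}_n$ is the set of permutations $w=a_1\cdots a_n$ of $[n]$. For $X\subseteq[n-1]$, $\overline{X}=[n-1]\setminus X$. For any word $w=a_1\cdots a_n$ (of $[n]$ or of a multiset), $C(w)=\{i\in[n-1] : a_j<a_k \text{ for all } j\leq i<k\}$ (strict inequality), and for $w\in\mathfrak{S}_n$, $D(w)=\{i : a_i>a_{i+1}\}$. Matrices are indexed by subsets of $[n-1]$: $\Gamma_{ST}=\#\{w\in\mathfrak{S}_n : C(w)=\overline{S},\ D(w)=T\}$, and $M_{ST}=1$ if $S\supseteq T$, $0$ otherwise. -}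

module Defs where

open import Data.Nat using (ℕ; zero; suc; _∸_; _⊔_; _<_; _+_; _*_)
open import Data.Nat.Properties using (_<?_; ≤-decTotalOrder; ≤-totalOrder)
import Data.Nat.Properties as ℕP
open import Data.Bool using (Bool; true; false; if_then_else_)
open import Data.Fin using (Fin; toℕ)
open import Data.List using (List; []; _∷_; [_]; _++_; map; concatMap; filter; length; replicate; take; drop; upTo; allFin; foldr)
open import Data.Nat.ListAction using (sum)
open import Data.List.Relation.Unary.All using (All)
import Data.List.Relation.Unary.All as All
open import Data.List.Relation.Binary.Permutation.Propositional using (_↭_; ↭-sym; ↭-trans; ↭⇒↭ₛ′)
import Data.List.Relation.Binary.Pointwise as PW
import Data.List.Sort.InsertionSort.Base
import Data.List.Sort.InsertionSort.Properties
open import Data.List.Relation.Unary.Sorted.TotalOrder.Properties using (↗↭↗⇒≋)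
import Data.List.Properties as LP
open import Data.Vec using (tabulate)
import Data.Vec.Properties as VP
import Data.Bool.Properties as BP
open import Data.Fin.Subset using (Subset; inside; outside; _∈_; _⊆_; ∁)
open import Data.Fin.Subset.Properties using (_∈?_; _⊆?_)
open import Data.Product using (_×_; _,_)
open import Relation.Nullary using (Dec; yes; no; ¬_)
open import Relation.Nullary.Decidable using (isYes; _×-dec_)
open import Relation.Unary using (Decidable)
open import Relation.Binary.PropositionalEquality using (_≡_; refl; cong; isEquivalence)

-- Words are lists of positive naturals.  A subset X ⊆ [n-1] with n = suc m
-- is a 'Subset m'; the index i : Fin m stands for the element (toℕ i + 1).

module SrtB = Data.List.Sort.InsertionSort.Base ≤-decTotalOrder
module Srt where
  open SrtB public using (sort)
  open Data.List.Sort.InsertionSort.Properties ≤-decTotalOrder public using (sort-↭; sort-↗)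

_↭?_ : (xs ys : List ℕ) → Dec (xs ↭ ys)
xs ↭? ys with LP.≡-dec ℕP._≟_ (Srt.sort xs) (Srt.sort ys)
... | yes eq = yes (↭-trans (↭-sym (Srt.sort-↭ xs)) (↭-trans (≡⇒↭ eq) (Srt.sort-↭ ys)))
  where
  ≡⇒↭ : ∀ {as bs : List ℕ} → as ≡ bs → as ↭ bs
  ≡⇒↭ refl = _↭_.refl
... | no neq = no λ p → neq (PW.Pointwise-≡⇒≡ (↗↭↗⇒≋ ≤-totalOrder (Srt.sort-↗ xs) (Srt.sort-↗ ys)
        (↭⇒↭ₛ′ isEquivalence (↭-trans (Srt.sort-↭ xs) (↭-trans p (↭-sym (Srt.sort-↭ ys)))))))

letters : ℕ → List ℕ
letters k = map suc (upTo k)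

words : ℕ → ℕ → List (List ℕ)
words k zero = [ [] ]
words k (suc n) = concatMap (λ a → map (a ∷_) (words k n)) (letters k)

maxL : List ℕ → ℕ
maxL = foldr _⊔_ 0

-- 𝔖_N : all permutations (words) of the multiset N (given as a list of
-- positive letters); every such word has length |N| and letters ≤ max N.
𝔖 : List ℕ → List (List ℕ)
𝔖 N = filter (_↭? N) (words (maxL N) (length N))

perm : ℕ → List ℕ
perm n = letters n

count : {P : List ℕ → Set} → Decidable P → List (List ℕ) → ℕ
count P? xs = length (filter P? xs)

cut? : (i : ℕ) (w : List ℕ) → Dec (All (λ a → All (a <_) (drop i w)) (take i w))
cut? i w = All.all? (λ a → All.all? (a <?_) (drop i w)) (take i w)

C : (m : ℕ) → List ℕ → Subset m
C m w = tabulate (λ i → isYes (cut? (suc (toℕ i)) w))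

descHead : List ℕ → Bool
descHead (a ∷ b ∷ _) = isYes (b <? a)
descHead _ = false

D : (m : ℕ) → List ℕ → Subset m
D m w = tabulate (λ i → descHead (drop (toℕ i) w))

_≟ₛ_ : ∀ {m} (X Y : Subset m) → Dec (X ≡ Y)
_≟ₛ_ = VP.≡-dec BP._≟_

elems : ∀ {m} → Subset m → List ℕ
elems {m} T = map (λ i → suc (toℕ i)) (filter (_∈? T) (allFin m))

multi : (j prev : ℕ) → List ℕ → (n : ℕ) → List ℕ
multi j prev [] n = replicate (n ∸ prev) j
multi j prev (i ∷ is) n = replicate (i ∸ prev) j ++ multi (suc j) i is n

N : (n : ℕ) → ∀ {m} → Subset m → List ℕ
N n T = multi 1 0 (elems T) n

allSubsets : ∀ m → List (Subset m)
allSubsets zero = [ Data.Vec.[] ]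
allSubsets (suc m) = map (outside Data.Vec.∷_) (allSubsets m) ++ map (inside Data.Vec.∷_) (allSubsets m)

Γ : (m : ℕ) → Subset m → Subset m → ℕ
Γ m S T = count (λ w → (C m w ≟ₛ ∁ S) ×-dec (D m w ≟ₛ T)) (𝔖 (perm (suc m)))

M : ∀ {m} → Subset m → Subset m → ℕ
M S T = if isYes (T ⊆? S) then 1 else 0

ΓM : (m : ℕ) → Subset m → Subset m → ℕ
ΓM m S T = sum (map (λ U → Γ m S U * M U T) (allSubsets m))

-- The second identity unfolds the product with M, and the third counts the pairs
-- (U, w) with D(w) = U ⊇ T̄ by w instead of by U. For the first, let β be N_T written in
-- increasing order, so that T̄ is the set of i with β_i = β_{i+1}. Call a word u of N_T and a
-- permutation w matching when u_{w_j} = β_j for all j. Listing the positions of u by increasing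
-- letter, equal letters from right to left, gives the unique matching w that descends inside
-- every block of equal letters of β, i.e. with D(w) ⊇ T̄; conversely every such w matches exactly
-- one u. Matching preserves C: the first i letters of u lie below the others exactly when they
-- are β_1, ..., β_i and β_i < β_{i+1}, which, as w descends inside blocks, happens exactly when
-- {w_1, ..., w_i} = [i].

module Submission where

open import Defs

open import Level using (Level)
open import Function using (_∘_; id; _on_)
open import Function.Bundles using (_⇔_; mk⇔; Equivalence)
import Algebra.Lattice.Properties.BooleanAlgebra as BooleanAlgebra
open import Data.Bool using (true; false; if_then_else_)
open import Data.Bool.Properties using (T-≡)
open import Data.Nat using (ℕ; zero; suc; _+_; _*_; _∸_; _⊓_; _≤_; _<_; z≤n; s≤s; s<s)
import Data.Nat.Properties as ℕ
open import Algebra.Properties.CommutativeSemigroup ℕ.+-commutativeSemigroup using (interchange)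
open import Data.Nat.ListAction using (sum)
open import Data.Product using (_×_; _,_; proj₁; proj₂; swap; ∃)
import Data.Product as Product
import Data.Product.Relation.Binary.Lex.NonStrict as Lex
import Data.Product.Relation.Binary.Pointwise.NonDependent as Pointwise
open import Data.Sum using (inj₁; inj₂)
open import Data.Fin using (Fin; toℕ)
import Data.Fin.Properties as Fin
open import Data.Fin.Subset using (Subset; inside; outside; _⊆_; ∁)
open import Data.Fin.Subset.Properties using (_⊆?_; _∈?_; ∪-∩-booleanAlgebra; out⊆; in⊆in; drop-∷-⊆)
import Data.Vec as Vec
import Data.Vec.Properties as Vec
open import Data.List
  using (List; []; _∷_; _++_; map; filter; length; concatMap; cartesianProductWith; upTo; zip; take; drop;
         replicate; allFin)
import Data.List.Properties as List
open import Data.List.Membership.Propositional using (_∈_)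
open import Data.List.Membership.Propositional.Properties
  using (∈-filter⁺; ∈-filter⁻; ∈-map⁺; ∈-upTo⁺; ∈-cartesianProductWith⁺)
open import Data.List.Relation.Unary.Any using (here; there)
open import Data.List.Relation.Unary.All as All using (All; []; _∷_)
import Data.List.Relation.Unary.All.Properties as All
open import Data.List.Relation.Unary.AllPairs using (AllPairs; []; _∷_)
open import Data.List.Relation.Unary.Linked as Linked using (Linked; []; [-]; _∷_)
import Data.List.Relation.Unary.Linked.Properties as Linked
open import Data.List.Relation.Unary.Unique.Propositional using (Unique)
import Data.List.Relation.Unary.Unique.Propositional.Properties as Unique
open import Data.List.Relation.Unary.Sorted.TotalOrder ℕ.≤-totalOrder using (Sorted)
open import Data.List.Relation.Unary.Sorted.TotalOrder.Properties using (↗↭↗⇒≋)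
import Data.List.Relation.Binary.Pointwise as Pointwise
open import Data.List.Relation.Binary.Permutation.Propositional
  using (_↭_; ↭-sym; ↭-trans; ↭-reflexive; ↭⇒↭ₛ; ↭⇒↭ₛ′)
import Data.List.Relation.Binary.Permutation.Propositional.Properties as ↭
open import Relation.Binary.Bundles using (DecTotalOrder)
open import Relation.Binary.Definitions using (DecidableEquality)
import Relation.Binary.Construct.Flip.EqAndOrd as Flip
open import Relation.Binary.PropositionalEquality
open import Data.List.Relation.Binary.Permutation.Setoid.Properties (setoid ℕ) using (Unique-resp-↭)
open import Relation.Nullary using (Dec; yes; no; ¬_; contradiction)
open import Relation.Nullary.Decidable
  using (isYes; isYes≗does; does-⇔; _×-dec_; toWitness; fromWitness)
open import Relation.Unary using (Pred; Decidable)
import Relation.Unary as U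
open import Relation.Unary.Properties using (∁?)

private variable
  a b c p q r : Level
  A : Set a
  B : Set b

-- Counting

𝟙 : Dec A → ℕ
𝟙 a? = if isYes a? then 1 else 0

count′ : {P : Pred A p} → Decidable P → List A → ℕ
count′ P? xs = length (filter P? xs)

module _ {P : Pred A p} (P? : Decidable P) where

  count′≡sum-𝟙 : ∀ xs → count′ P? xs ≡ sum (map (𝟙 ∘ P?) xs)
  count′≡sum-𝟙 [] = refl
  count′≡sum-𝟙 (x ∷ xs) with P? x
  ... | yes _ = cong suc (count′≡sum-𝟙 xs)
  ... | no _ = count′≡sum-𝟙 xs

  count′-none : ∀ {xs} → (∀ {y} → y ∈ xs → ¬ P y) → count′ P? xs ≡ 0
  count′-none ¬P = cong length (List.filter-none P? (All.tabulate ¬P))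

  count′-single : ∀ {x xs} → Unique xs → x ∈ xs → P x → (∀ {y} → y ∈ xs → P y → y ≡ x) →
                  count′ P? xs ≡ 1
  count′-single {xs = y ∷ ys} (y∉ys ∷ _) _ _ only with P? y
  ... | yes Py = cong suc (count′-none λ z∈ys Pz →
        All.lookup y∉ys z∈ys (trans (only (here refl) Py) (sym (only (there z∈ys) Pz))))
  count′-single _ (here refl) Px _ | no ¬Py = contradiction Px ¬Py
  count′-single (_ ∷ ys-unique) (there x∈ys) Px only | no _ =
    count′-single ys-unique x∈ys Px (only ∘ there)

  count′-unique : ∀ {x xs} {Q : Set q} (Q? : Dec Q) → Unique xs → (Q → x ∈ xs) →
                  (∀ {y} → y ∈ xs → P y ⇔ (y ≡ x × Q)) → count′ P? xs ≡ 𝟙 Q?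
  count′-unique (no ¬q) _ _ P⇔ = count′-none λ y∈xs Py → ¬q (proj₂ (Equivalence.to (P⇔ y∈xs) Py))
  count′-unique (yes q) xs-unique x∈xs P⇔ =
    count′-single xs-unique (x∈xs q) (Equivalence.from (P⇔ (x∈xs q)) (refl , q))
                  (λ y∈xs → proj₁ ∘ Equivalence.to (P⇔ y∈xs))

sum-map-+ : ∀ (f g : A → ℕ) xs → sum (map (λ x → f x + g x) xs) ≡ sum (map f xs) + sum (map g xs)
sum-map-+ f g [] = refl
sum-map-+ f g (x ∷ xs) = trans (cong (f x + g x +_) (sum-map-+ f g xs)) (interchange (f x) (g x) _ _)

sum-map-comm : ∀ (f : A → B → ℕ) xs ys →
               sum (map (λ x → sum (map (f x) ys)) xs) ≡ sum (map (λ y → sum (map (λ x → f x y) xs)) ys)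
sum-map-comm f [] ys = sym (sum-map-zero ys)
  where
  sum-map-zero : ∀ ys → sum (map (λ _ → 0) ys) ≡ 0
  sum-map-zero [] = refl
  sum-map-zero (_ ∷ ys) = sum-map-zero ys
sum-map-comm f (x ∷ xs) ys = trans (cong (sum (map (f x) ys) +_) (sum-map-comm f xs ys))
  (sym (sum-map-+ (f x) (λ y → sum (map (λ x → f x y) xs)) ys))

module _ {R : A → B → Set r} (R? : ∀ x y → Dec (R x y)) where

  sum-count′-comm : ∀ xs ys →
    sum (map (λ x → count′ (R? x) ys) xs) ≡ sum (map (λ y → count′ (λ x → R? x y) xs) ys)
  sum-count′-comm xs ys = begin
    sum (map (λ x → count′ (R? x) ys) xs)
      ≡⟨ cong sum (List.map-cong (λ x → count′≡sum-𝟙 (R? x) ys) xs) ⟩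
    sum (map (λ x → sum (map (λ y → 𝟙 (R? x y)) ys)) xs)
      ≡⟨ sum-map-comm (λ x y → 𝟙 (R? x y)) xs ys ⟩
    sum (map (λ y → sum (map (λ x → 𝟙 (R? x y)) xs)) ys)
      ≡⟨ cong sum (List.map-cong (λ y → count′≡sum-𝟙 (λ x → R? x y) xs) ys) ⟨
    sum (map (λ y → count′ (λ x → R? x y) xs) ys) ∎
    where open ≡-Reasoning

sum-map-*𝟙 : ∀ {P : Pred A p} (P? : Decidable P) (f : A → ℕ) xs →
             sum (map (λ x → f x * 𝟙 (P? x)) xs) ≡ sum (map f (filter P? xs))
sum-map-*𝟙 P? f [] = refl
sum-map-*𝟙 P? f (x ∷ xs) with P? x
... | yes _ = cong₂ _+_ (ℕ.*-identityʳ (f x)) (sum-map-*𝟙 P? f xs)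
... | no _ = cong₂ _+_ (ℕ.*-zeroʳ (f x)) (sum-map-*𝟙 P? f xs)

module _ (_≟_ : DecidableEquality A) {P₁ : Pred A p} {P₂ : Pred B q}
         (P₁? : Decidable P₁) (P₂? : Decidable P₂) (f : A → B) (g : B → A) where

  count′-bijection : ∀ {xs ys} → Unique xs → Unique ys →
    (∀ {x} → x ∈ xs → P₁ x → f x ∈ ys × P₂ (f x) × g (f x) ≡ x) →
    (∀ {y} → y ∈ ys → P₂ y → g y ∈ xs × P₁ (g y) × f (g y) ≡ y) →
    count′ P₁? xs ≡ count′ P₂? ys
  count′-bijection {xs} {ys} xs-unique ys-unique f-spec g-spec = begin
    count′ P₁? xs                                  ≡⟨ count′≡sum-𝟙 P₁? xs ⟩
    sum (map (𝟙 ∘ P₁?) xs)                         ≡⟨ cong sum (List.map-cong-local (All.tabulate fibre-f)) ⟨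
    sum (map (λ x → count′ (λ y → R? x y) ys) xs)  ≡⟨ sum-count′-comm R? xs ys ⟩
    sum (map (λ y → count′ (λ x → R? x y) xs) ys)  ≡⟨ cong sum (List.map-cong-local (All.tabulate fibre-g)) ⟩
    sum (map (𝟙 ∘ P₂?) ys)                         ≡⟨ count′≡sum-𝟙 P₂? ys ⟨
    count′ P₂? ys                                  ∎
    where
    open ≡-Reasoning
    R? : ∀ x y → Dec (x ≡ g y × P₂ y)
    R? x y = (x ≟ g y) ×-dec P₂? y
    fibre-f : ∀ {x} → x ∈ xs → count′ (R? x) ys ≡ 𝟙 (P₁? x)
    fibre-f {x} x∈xs = count′-unique (R? x) (P₁? x) ys-unique (proj₁ ∘ f-spec x∈xs) λ y∈ys → mk⇔
      (λ { (refl , P₂y) → let _ , P₁gy , fgy≡y = g-spec y∈ys P₂y in sym fgy≡y , P₁gy })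
      (λ { (refl , P₁x) → let _ , P₂fx , gfx≡x = f-spec x∈xs P₁x in sym gfx≡x , P₂fx })
    fibre-g : ∀ {y} → y ∈ ys → count′ (λ x → R? x y) xs ≡ 𝟙 (P₂? y)
    fibre-g {y} y∈ys =
      count′-unique (λ x → R? x y) (P₂? y) xs-unique (proj₁ ∘ g-spec y∈ys) λ _ → mk⇔ id id

-- Enumerating words and subsets

concatMap-map≡cartesianProductWith : ∀ {C : Set c} (f : A → B → C) xs ys →
  concatMap (λ x → map (f x) ys) xs ≡ cartesianProductWith f xs ys
concatMap-map≡cartesianProductWith f [] ys = refl
concatMap-map≡cartesianProductWith f (x ∷ xs) ys =
  cong (map (f x) ys ++_) (concatMap-map≡cartesianProductWith f xs ys)

letters-unique : ∀ k → Unique (letters k)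
letters-unique k = Unique.map⁺ ℕ.suc-injective (Unique.upTo⁺ k)

letters-length : ∀ n → length (letters n) ≡ n
letters-length n = trans (List.length-map suc (upTo n)) (List.length-upTo n)

letters-strict : ∀ n → Linked _<_ (letters n)
letters-strict n = Linked.map⁺ (Linked.map s<s (Linked.applyUpTo⁺₂ id n ℕ.n<1+n))

letters-sorted : ∀ n → Sorted (letters n)
letters-sorted n = Linked.map ℕ.<⇒≤ (letters-strict n)

All-map-suc-positive : ∀ xs → All (1 ≤_) (map suc xs)
All-map-suc-positive xs = All.map⁺ (All.tabulate {xs = xs} λ _ → s≤s z≤n)

∈-letters⁺ : ∀ {k a} → 1 ≤ a → a ≤ k → a ∈ letters k
∈-letters⁺ {a = suc a} _ a<k = ∈-map⁺ suc (∈-upTo⁺ a<k)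

words-unique : ∀ k n → Unique (words k n)
words-unique k zero = [] ∷ []
words-unique k (suc n) = subst Unique (sym (concatMap-map≡cartesianProductWith _∷_ (letters k) (words k n)))
  (Unique.cartesianProductWith⁺ _∷_ List.∷-injective (letters-unique k) (words-unique k n))

∈-words⁺ : ∀ {k} n {u} → length u ≡ n → All (_∈ letters k) u → u ∈ words k n
∈-words⁺ zero {[]} _ [] = here refl
∈-words⁺ {k} (suc n) {a ∷ u} |u|≡n (a∈ ∷ u∈) =
  subst (a ∷ u ∈_) (sym (concatMap-map≡cartesianProductWith _∷_ (letters k) (words k n)))
    (∈-cartesianProductWith⁺ _∷_ a∈ (∈-words⁺ n (ℕ.suc-injective |u|≡n) u∈))

≤-maxL : ∀ {a xs} → a ∈ xs → a ≤ maxL xs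
≤-maxL {xs = x ∷ xs} (here refl) = ℕ.m≤m⊔n x (maxL xs)
≤-maxL {xs = x ∷ xs} (there a∈xs) = ℕ.≤-trans (≤-maxL a∈xs) (ℕ.m≤n⊔m x (maxL xs))

𝔖-unique : ∀ N → Unique (𝔖 N)
𝔖-unique N = Unique.filter⁺ (_↭? N) (words-unique (maxL N) (length N))

∈-𝔖⁺ : ∀ {N u} → All (1 ≤_) N → u ↭ N → u ∈ 𝔖 N
∈-𝔖⁺ {N} N-positive u↭N =
  ∈-filter⁺ (_↭? N) (∈-words⁺ (length N) (↭.↭-length u↭N) (All.tabulate letter)) u↭N
  where
  letter : ∀ {a} → a ∈ _ → a ∈ letters (maxL N)
  letter a∈u = let a∈N = ↭.∈-resp-↭ u↭N a∈u in
    ∈-letters⁺ (All.lookup N-positive a∈N) (≤-maxL a∈N)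

∈-𝔖⁻ : ∀ {N u} → u ∈ 𝔖 N → u ↭ N
∈-𝔖⁻ {N} = proj₂ ∘ ∈-filter⁻ (_↭? N) {xs = words (maxL N) (length N)}

allSubsets-suc : ∀ m →
  allSubsets (suc m) ≡ cartesianProductWith Vec._∷_ (outside ∷ inside ∷ []) (allSubsets m)
allSubsets-suc m = cong (map (outside Vec.∷_) (allSubsets m) ++_) (sym (List.++-identityʳ _))

allSubsets-unique : ∀ m → Unique (allSubsets m)
allSubsets-unique zero = [] ∷ []
allSubsets-unique (suc m) = subst Unique (sym (allSubsets-suc m))
  (Unique.cartesianProductWith⁺ Vec._∷_ Vec.∷-injective (((λ ()) ∷ []) ∷ [] ∷ []) (allSubsets-unique m))

∈-allSubsets : ∀ {m} (X : Subset m) → X ∈ allSubsets m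
∈-allSubsets Vec.[] = here refl
∈-allSubsets {suc m} (x Vec.∷ X) = subst (x Vec.∷ X ∈_) (sym (allSubsets-suc m))
  (∈-cartesianProductWith⁺ Vec._∷_ (∈-bools x) (∈-allSubsets X))
  where
  ∈-bools : ∀ x → x ∈ outside ∷ inside ∷ []
  ∈-bools false = here refl
  ∈-bools true = there (here refl)

-- Γ M as a sum over supersets

∁-involutive : ∀ {m} (S : Subset m) → ∁ (∁ S) ≡ S
∁-involutive {m} = ¬-involutive
  where open BooleanAlgebra (∪-∩-booleanAlgebra m) using (¬-involutive)

ΓM≡sum-Γ-⊇ : ∀ m (X Y : Subset m) → ΓM m X Y ≡ sum (map (Γ m X) (filter (Y ⊆?_) (allSubsets m)))
ΓM≡sum-Γ-⊇ m X Y = sum-map-*𝟙 (Y ⊆?_) (Γ m X) (allSubsets m)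

sum-Γ-⊇≡count : ∀ m (S Y : Subset m) →
  sum (map (Γ m (∁ S)) (filter (Y ⊆?_) (allSubsets m)))
    ≡ count (λ w → (C m w ≟ₛ S) ×-dec (Y ⊆? D m w)) (𝔖 (perm (suc m)))
sum-Γ-⊇≡count m S Y = begin
  sum (map (λ U → count′ (λ w → R? U w) 𝔖ₙ) ⊇Y) ≡⟨ sum-count′-comm R? ⊇Y 𝔖ₙ ⟩
  sum (map (λ w → count′ (λ U → R? U w) ⊇Y) 𝔖ₙ) ≡⟨ cong sum (List.map-cong fibre 𝔖ₙ) ⟩
  sum (map (𝟙 ∘ Q?) 𝔖ₙ)                          ≡⟨ count′≡sum-𝟙 Q? 𝔖ₙ ⟨
  count Q? 𝔖ₙ                                    ∎
  where
  open ≡-Reasoning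
  𝔖ₙ = 𝔖 (perm (suc m))
  ⊇Y = filter (Y ⊆?_) (allSubsets m)
  R? = λ U w → (C m w ≟ₛ ∁ (∁ S)) ×-dec (D m w ≟ₛ U)
  Q? = λ w → (C m w ≟ₛ S) ×-dec (Y ⊆? D m w)
  fibre : ∀ w → count′ (λ U → R? U w) ⊇Y ≡ 𝟙 (Q? w)
  fibre w = count′-unique (λ U → R? U w) (Q? w) (Unique.filter⁺ (Y ⊆?_) (allSubsets-unique m))
    (λ (_ , Y⊆D) → ∈-filter⁺ (Y ⊆?_) (∈-allSubsets (D m w)) Y⊆D) λ U∈⊇Y → mk⇔
    (λ { (C≡S , refl) →
           refl , trans C≡S (∁-involutive S) , proj₂ (∈-filter⁻ (Y ⊆?_) {xs = allSubsets m} U∈⊇Y) })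
    (λ { (refl , C≡S , _) → trans C≡S (sym (∁-involutive S)) , refl })

-- Sorting pairs lexicographically

≤ₗ-decTotalOrder : DecTotalOrder _ _ _
≤ₗ-decTotalOrder = Lex.×-decTotalOrder ℕ.≤-decTotalOrder (Flip.decTotalOrder ℕ.≤-decTotalOrder)

open DecTotalOrder ≤ₗ-decTotalOrder using () renaming (_≤_ to _≤ₗ_)
open import Data.List.Sort ≤ₗ-decTotalOrder
  using () renaming (sort to sortₗ; sort-↭ to sortₗ-↭; sort-↗ to sortₗ-↗)
open import Data.List.Relation.Unary.Sorted.TotalOrder (DecTotalOrder.totalOrder ≤ₗ-decTotalOrder)
  using () renaming (Sorted to Sortedₗ)

≤ₗ⇒≤ : ∀ {x y} → x ≤ₗ y → proj₁ x ≤ proj₁ y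
≤ₗ⇒≤ (inj₁ (x≤y , _)) = x≤y
≤ₗ⇒≤ (inj₂ (refl , _)) = ℕ.≤-refl

<⇒≤ₗ : ∀ {x y} → proj₁ x < proj₁ y → x ≤ₗ y
<⇒≤ₗ x<y = inj₁ (ℕ.<⇒≤ x<y , ℕ.<⇒≢ x<y)

≤ₗ-tie : ∀ {x y} → proj₁ x ≡ proj₁ y → x ≤ₗ y → proj₂ y ≤ proj₂ x
≤ₗ-tie x≡y (inj₁ (_ , x≢y)) = contradiction x≡y x≢y
≤ₗ-tie _ (inj₂ (_ , y≤x)) = y≤x

≤ₗ-intro : ∀ {x y} → proj₁ x ≤ proj₁ y → (proj₁ x ≡ proj₁ y → proj₂ y ≤ proj₂ x) → x ≤ₗ y
≤ₗ-intro {x} {y} x≤y tie with proj₁ x ℕ.≟ proj₁ y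
... | yes x≡y = inj₂ (x≡y , tie x≡y)
... | no x≢y = inj₁ (x≤y , x≢y)

↗↭↗⇒≡ : ∀ {xs ys} → Sorted xs → Sorted ys → xs ↭ ys → xs ≡ ys
↗↭↗⇒≡ xs↗ ys↗ xs↭ys =
  Pointwise.Pointwise-≡⇒≡ (↗↭↗⇒≋ ℕ.≤-totalOrder xs↗ ys↗ (↭⇒↭ₛ′ isEquivalence xs↭ys))

↗↭↗⇒≡ₗ : ∀ {xs ys} → Sortedₗ xs → Sortedₗ ys → xs ↭ ys → xs ≡ ys
↗↭↗⇒≡ₗ xs↗ ys↗ xs↭ys = Pointwise.Pointwise-≡⇒≡ (Pointwise.map Pointwise.≡×≡⇒≡
  (↗↭↗⇒≋ (DecTotalOrder.totalOrder ≤ₗ-decTotalOrder) xs↗ ys↗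
    (↭⇒↭ₛ′ (DecTotalOrder.Eq.isEquivalence ≤ₗ-decTotalOrder) xs↭ys)))

map-proj₁-zip : ∀ {xs : List A} {ys : List B} → length xs ≡ length ys → map proj₁ (zip xs ys) ≡ xs
map-proj₁-zip {xs = []} {[]} _ = refl
map-proj₁-zip {xs = x ∷ _} {_ ∷ _} |xs|≡|ys| = cong (x ∷_) (map-proj₁-zip (ℕ.suc-injective |xs|≡|ys|))

map-proj₂-zip : ∀ {xs : List A} {ys : List B} → length xs ≡ length ys → map proj₂ (zip xs ys) ≡ ys
map-proj₂-zip {xs = []} {[]} _ = refl
map-proj₂-zip {xs = _ ∷ _} {y ∷ _} |xs|≡|ys| = cong (y ∷_) (map-proj₂-zip (ℕ.suc-injective |xs|≡|ys|))

zip-map-proj : ∀ (ps : List (A × B)) → zip (map proj₁ ps) (map proj₂ ps) ≡ ps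
zip-map-proj [] = refl
zip-map-proj (p ∷ ps) = cong (p ∷_) (zip-map-proj ps)

zip-↭-swap : ∀ {xs xs′ : List A} {ys ys′ : List B} →
             zip xs ys ↭ zip xs′ ys′ → zip ys xs ↭ zip ys′ xs′
zip-↭-swap {xs = xs} {xs′} {ys} {ys′} p =
  subst₂ _↭_ (sym (List.zip-flip ys xs)) (sym (List.zip-flip ys′ xs′)) (↭.map⁺ swap p)

zip-↭⇒↭ʳ : ∀ {xs xs′ : List A} {ys ys′ : List B} → length xs ≡ length ys → length xs′ ≡ length ys′ →
           zip xs ys ↭ zip xs′ ys′ → ys ↭ ys′
zip-↭⇒↭ʳ |xs|≡|ys| |xs′|≡|ys′| p =
  subst₂ _↭_ (map-proj₂-zip |xs|≡|ys|) (map-proj₂-zip |xs′|≡|ys′|) (↭.map⁺ proj₂ p)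

zip-take-drop : ∀ i (xs : List A) (ys : List B) →
                zip xs ys ≡ zip (take i xs) (take i ys) ++ zip (drop i xs) (drop i ys)
zip-take-drop zero xs ys = refl
zip-take-drop (suc i) [] ys = refl
zip-take-drop (suc i) (x ∷ xs) [] = sym (List.zipWith-zeroʳ _,_ (drop i xs))
zip-take-drop (suc i) (x ∷ xs) (y ∷ ys) = cong ((x , y) ∷_) (zip-take-drop i xs ys)

All-zipˡ : ∀ {P : Pred A p} {xs} {ys : List B} → All P xs → All (P ∘ proj₁) (zip xs ys)
All-zipˡ [] = []
All-zipˡ {ys = []} (_ ∷ _) = []
All-zipˡ {ys = _ ∷ _} (px ∷ pxs) = px ∷ All-zipˡ pxs

Linked-zipˡ : ∀ {R : A → A → Set r} {xs} {ys : List B} → Linked R xs → Linked (R on proj₁) (zip xs ys)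
Linked-zipˡ [] = []
Linked-zipˡ {ys = []} [-] = []
Linked-zipˡ {ys = _ ∷ _} [-] = [-]
Linked-zipˡ {ys = []} (_ ∷ _) = []
Linked-zipˡ {ys = _ ∷ []} (_ ∷ _) = [-]
Linked-zipˡ {ys = _ ∷ _ ∷ _} (r ∷ rs) = r ∷ Linked-zipˡ rs

Linked-zipʳ : ∀ {R : B → B → Set r} {xs : List A} {ys} → Linked R ys → Linked (R on proj₂) (zip xs ys)
Linked-zipʳ {xs = xs} {ys} rs = subst (Linked _) (sym (List.zip-flip xs ys)) (Linked.map⁺ (Linked-zipˡ rs))

zip-↭-injectiveʳ : ∀ {ks vs vs′} → length ks ≡ length vs → length ks ≡ length vs′ →
  Sortedₗ (zip ks vs) → Sortedₗ (zip ks vs′) → zip ks vs ↭ zip ks vs′ → vs ≡ vs′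
zip-↭-injectiveʳ |ks|≡|vs| |ks|≡|vs′| zip↗ zip′↗ zip↭ =
  trans (sym (map-proj₂-zip |ks|≡|vs|))
    (trans (cong (map proj₂) (↗↭↗⇒≡ₗ zip↗ zip′↗ zip↭)) (map-proj₂-zip |ks|≡|vs′|))

reorder : List ℕ → List ℕ → List ℕ
reorder ks vs = map proj₂ (sortₗ (zip ks vs))

zip-reorder : ∀ {ks vs zs} → length ks ≡ length vs → ks ↭ zs → Sorted zs →
              zip zs (reorder ks vs) ≡ sortₗ (zip ks vs)
zip-reorder {ks} {vs} {zs} |ks|≡|vs| ks↭zs zs↗ = begin
  zip zs (reorder ks vs)                         ≡⟨ cong (λ keys → zip keys (reorder ks vs)) keys≡zs ⟨
  zip (map proj₁ sorted) (map proj₂ sorted)      ≡⟨ zip-map-proj sorted ⟩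
  sorted                                         ∎
  where
  open ≡-Reasoning
  sorted = sortₗ (zip ks vs)
  keys≡zs : map proj₁ sorted ≡ zs
  keys≡zs = ↗↭↗⇒≡ (Linked.map⁺ (Linked.map ≤ₗ⇒≤ (sortₗ-↗ _))) zs↗
    (↭-trans (↭.map⁺ proj₁ (sortₗ-↭ _)) (subst (_↭ zs) (sym (map-proj₁-zip |ks|≡|vs|)) ks↭zs))

reorder-↭ : ∀ {ks vs} → length ks ≡ length vs → reorder ks vs ↭ vs
reorder-↭ {ks} {vs} |ks|≡|vs| =
  subst (reorder ks vs ↭_) (map-proj₂-zip |ks|≡|vs|) (↭.map⁺ proj₂ (sortₗ-↭ (zip ks vs)))

TieDescent : ℕ × ℕ → ℕ × ℕ → Set
TieDescent (k , v) (k′ , v′) = k ≡ k′ → v′ < v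

DescentsWithin : List ℕ → List ℕ → Set
DescentsWithin ks vs = Linked TieDescent (zip ks vs)

DescentsWithin⇒Sortedₗ : ∀ {ks vs} → Sorted ks → DescentsWithin ks vs → Sortedₗ (zip ks vs)
DescentsWithin⇒Sortedₗ ks↗ descents =
  Linked.zipWith (λ (k≤k′ , tie) → ≤ₗ-intro k≤k′ (ℕ.<⇒≤ ∘ tie)) (Linked-zipˡ ks↗ , descents)

Sortedₗ⇒DescentsWithin : ∀ {ks vs} → Sortedₗ (zip ks vs) → Unique vs → DescentsWithin ks vs
Sortedₗ⇒DescentsWithin zip↗ vs-unique =
  Linked.zipWith (λ (p≤ₗq , v≢v′) k≡k′ → ℕ.≤∧≢⇒< (≤ₗ-tie k≡k′ p≤ₗq) (v≢v′ ∘ sym))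
    (zip↗ , Linked-zipʳ (Linked.AllPairs⇒Linked vs-unique))

-- Cuts

_≪_ : List ℕ → List ℕ → Set
xs ≪ ys = All (λ x → All (x <_) ys) xs

Cut : ℕ → List ℕ → Set
Cut i v = take i v ≪ drop i v

≪-resp-↭ : ∀ {xs xs′ ys ys′} → xs ↭ xs′ → ys ↭ ys′ → xs ≪ ys → xs′ ≪ ys′
≪-resp-↭ xs↭xs′ ys↭ys′ = ↭.All-resp-↭ xs↭xs′ ∘ All.map (↭.All-resp-↭ ys↭ys′)

Cut-strict : ∀ i {xs} → AllPairs _<_ xs → Cut i xs
Cut-strict zero _ = []
Cut-strict (suc i) {[]} _ = []
Cut-strict (suc i) {x ∷ xs} (x< ∷ xs<) = All.drop⁺ i x< ∷ Cut-strict i xs<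

Sorted-++⁺ : ∀ {xs ys} → Sorted xs → Sorted ys → xs ≪ ys → Sorted (xs ++ ys)
Sorted-++⁺ [] ys↗ _ = ys↗
Sorted-++⁺ {ys = []} [-] _ _ = [-]
Sorted-++⁺ {ys = _ ∷ _} [-] ys↗ ((x<y ∷ _) ∷ []) = ℕ.<⇒≤ x<y ∷ ys↗
Sorted-++⁺ (x≤x′ ∷ xs↗) ys↗ (_ ∷ xs≪ys) = x≤x′ ∷ Sorted-++⁺ xs↗ ys↗ xs≪ys

take-length-++ : ∀ (xs ys : List A) → take (length xs) (xs ++ ys) ≡ xs
take-length-++ [] ys = refl
take-length-++ (x ∷ xs) ys = cong (x ∷_) (take-length-++ xs ys)

drop-length-++ : ∀ (xs ys : List A) → drop (length xs) (xs ++ ys) ≡ ys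
drop-length-++ [] ys = refl
drop-length-++ (x ∷ xs) ys = drop-length-++ xs ys

Cut-↭-sorted : ∀ i {xs zs} → i ≤ length xs → Cut i xs → xs ↭ zs → Sorted zs →
               take i xs ↭ take i zs × drop i xs ↭ drop i zs
Cut-↭-sorted i {xs} {zs} i≤|xs| cut xs↭zs zs↗ =
  subst (take i xs ↭_) (sym take-zs) (↭-sym (sort-↭ _)) ,
  subst (drop i xs ↭_) (sym drop-zs) (↭-sym (sort-↭ _))
  where
  open import Data.List.Sort ℕ.≤-decTotalOrder using (sort; sort-↭; sort-↗)
  front = sort (take i xs)
  back = sort (drop i xs)
  front++back≡zs : front ++ back ≡ zs
  front++back≡zs = ↗↭↗⇒≡
    (Sorted-++⁺ (sort-↗ _) (sort-↗ _) (≪-resp-↭ (↭-sym (sort-↭ _)) (↭-sym (sort-↭ _)) cut)) zs↗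
    (↭-trans (↭.++⁺ (sort-↭ _) (sort-↭ _)) (subst (_↭ zs) (sym (List.take++drop≡id i xs)) xs↭zs))
  |front|≡i : length front ≡ i
  |front|≡i = trans (↭.↭-length (sort-↭ _)) (trans (List.length-take i xs) (ℕ.m≤n⇒m⊓n≡m i≤|xs|))
  take-zs : take i zs ≡ front
  take-zs = subst₂ (λ j ws → take j ws ≡ front) |front|≡i front++back≡zs (take-length-++ front back)
  drop-zs : drop i zs ≡ back
  drop-zs = subst₂ (λ j ws → drop j ws ≡ back) |front|≡i front++back≡zs (drop-length-++ front back)

↭-partition : ∀ {P : Pred A p} (P? : Decidable P) {xs₁ xs₂ ys₁ ys₂} →
  All P xs₁ → All (U.∁ P) xs₂ → All P ys₁ → All (U.∁ P) ys₂ →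
  xs₁ ++ xs₂ ↭ ys₁ ++ ys₂ → xs₁ ↭ ys₁ × xs₂ ↭ ys₂
↭-partition {P = P} P? Pxs₁ ¬Pxs₂ Pys₁ ¬Pys₂ p =
  subst₂ _↭_ (kept Pxs₁ ¬Pxs₂) (kept Pys₁ ¬Pys₂) (↭.filter-↭ P? p) ,
  subst₂ _↭_ (rejected Pxs₁ ¬Pxs₂) (rejected Pys₁ ¬Pys₂) (↭.filter-↭ (∁? P?) p)
  where
  kept : ∀ {as bs} → All P as → All (U.∁ P) bs → filter P? (as ++ bs) ≡ as
  kept {as} {bs} Pas ¬Pbs = begin
    filter P? (as ++ bs)              ≡⟨ List.filter-++ P? as bs ⟩
    filter P? as ++ filter P? bs      ≡⟨ cong₂ _++_ (List.filter-all P? Pas) (List.filter-none P? ¬Pbs) ⟩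
    as ++ []                          ≡⟨ List.++-identityʳ as ⟩
    as                                ∎
    where open ≡-Reasoning
  rejected : ∀ {as bs} → All P as → All (U.∁ P) bs → filter (∁? P?) (as ++ bs) ≡ bs
  rejected {as} {bs} Pas ¬Pbs = begin
    filter (∁? P?) (as ++ bs)                 ≡⟨ List.filter-++ (∁? P?) as bs ⟩
    filter (∁? P?) as ++ filter (∁? P?) bs    ≡⟨ cong₂ _++_ (List.filter-none (∁? P?) (All.map (λ Pa ¬Pa → ¬Pa Pa) Pas))
                                                              (List.filter-all (∁? P?) ¬Pbs) ⟩
    bs                                        ∎
    where open ≡-Reasoning

-- The pairs whose key lies below all of drop i xs′ are exactly the first i on either side.
Cut-↭-zip : ∀ i {xs ys xs′ ys′} → length xs ≡ length ys → length xs′ ≡ length ys′ →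
  zip xs ys ↭ zip xs′ ys′ → Cut i xs′ → take i xs ↭ take i xs′ → drop i xs ↭ drop i xs′ →
  take i ys ↭ take i ys′ × drop i ys ↭ drop i ys′
Cut-↭-zip i {xs} {ys} {xs′} {ys′} |xs|≡|ys| |xs′|≡|ys′| zip↭ cut take↭ drop↭ =
  zip-↭⇒↭ʳ (length-take-cong |xs|≡|ys|) (length-take-cong |xs′|≡|ys′|) (proj₁ blocks) ,
  zip-↭⇒↭ʳ (length-drop-cong |xs|≡|ys|) (length-drop-cong |xs′|≡|ys′|) (proj₂ blocks)
  where
  not-below-itself : ∀ zs → All (λ z → ¬ All (z <_) zs) zs
  not-below-itself zs = All.tabulate λ z∈zs z<zs → ℕ.<-irrefl refl (All.lookup z<zs z∈zs)
  blocks = ↭-partition (λ (k , _) → All.all? (k ℕ.<?_) (drop i xs′))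
    (All-zipˡ (↭.All-resp-↭ (↭-sym take↭) cut))
    (All-zipˡ (↭.All-resp-↭ (↭-sym drop↭) (not-below-itself (drop i xs′))))
    (All-zipˡ cut)
    (All-zipˡ (not-below-itself (drop i xs′)))
    (subst₂ _↭_ (zip-take-drop i xs ys) (zip-take-drop i xs′ ys′) zip↭)
  length-take-cong : ∀ {as bs : List ℕ} → length as ≡ length bs → length (take i as) ≡ length (take i bs)
  length-take-cong {as} {bs} eq =
    trans (List.length-take i as) (trans (cong (i ⊓_) eq) (sym (List.length-take i bs)))
  length-drop-cong : ∀ {as bs : List ℕ} → length as ≡ length bs → length (drop i as) ≡ length (drop i bs)
  length-drop-cong {as} {bs} eq =
    trans (List.length-drop i as) (trans (cong (_∸ i) eq) (sym (List.length-drop i bs)))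

-- A tie k_i = k_{i+1} would force v_i > v_{i+1}, which the cut at i in vs forbids.
Cut-keys : ∀ i {ks vs} → Sorted ks → DescentsWithin ks vs → length ks ≡ length vs → Cut i vs → Cut i ks
Cut-keys zero _ _ _ _ = []
Cut-keys (suc i) {[]} _ _ _ _ = []
Cut-keys (suc i) {k ∷ ks} {v ∷ vs} ks↗ descents |ks|≡|vs| (v≪ ∷ cut) =
  k<drop i ks↗ descents (ℕ.suc-injective |ks|≡|vs|) v≪ rest ∷ rest
  where
  rest : Cut i ks
  rest = Cut-keys i (Linked.tail ks↗) (Linked.tail descents) (ℕ.suc-injective |ks|≡|vs|) cut
  k<drop : ∀ i {ks vs} → Sorted (k ∷ ks) → DescentsWithin (k ∷ ks) (v ∷ vs) → length ks ≡ length vs →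
           All (v <_) (drop i vs) → Cut i ks → All (k <_) (drop i ks)
  k<drop i {[]} _ _ _ _ _ = All.drop⁺ i []
  k<drop zero {k′ ∷ ks} {v′ ∷ vs} (k≤k′ ∷ ks↗) (tie ∷ _) _ (v<v′ ∷ _) _ =
    All.map (ℕ.<-≤-trans k<k′) (Linked.Linked⇒All ℕ.≤-trans ℕ.≤-refl ks↗)
    where
    k<k′ : k < k′
    k<k′ = ℕ.≤∧≢⇒< k≤k′ (λ k≡k′ → ℕ.<-asym v<v′ (tie k≡k′))
  k<drop (suc i) {k′ ∷ ks} (k≤k′ ∷ _) _ _ _ (k′≪ ∷ _) = All.map (ℕ.≤-<-trans k≤k′) k′≪

C-cong : ∀ {m u w} → (∀ {i} → i ≤ suc m → Cut i u ⇔ Cut i w) → C m u ≡ C m w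
C-cong {m} {u} {w} cut⇔ = Vec.tabulate-cong λ x →
  let i≤ = ℕ.m≤n⇒m≤1+n (Fin.toℕ<n x) in
  trans (isYes≗does (cut? _ u))
    (trans (does-⇔ (cut⇔ i≤) (cut? _ u) (cut? _ w)) (sym (isYes≗does (cut? _ w))))

-- The multiset N_T

multi-shift : ∀ j p es n → multi j (suc p) (map suc es) (suc n) ≡ multi j p es n
multi-shift j p [] n = refl
multi-shift j p (e ∷ es) n = cong (replicate (e ∸ p) j ++_) (multi-shift (suc j) e es n)

multi-suc : ∀ j p es n → multi (suc j) p es n ≡ map suc (multi j p es n)
multi-suc j p [] n = sym (List.map-replicate suc (n ∸ p) j)
multi-suc j p (e ∷ es) n = trans
  (cong₂ _++_ (sym (List.map-replicate suc (e ∸ p) j)) (multi-suc (suc j) e es n))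
  (sym (List.map-++ suc (replicate (e ∸ p) j) (multi (suc j) e es n)))

multi-0 : ∀ j es n → multi j 0 (map suc es) (suc n) ≡ j ∷ multi j 0 es n
multi-0 j [] n = refl
multi-0 j (e ∷ es) n = cong (λ rest → j ∷ replicate e j ++ rest) (multi-shift (suc j) e es n)

filter-∈?-suc : ∀ {m} b (T : Subset m) xs →
  filter (_∈? b Vec.∷ T) (map Fin.suc xs) ≡ map Fin.suc (filter (_∈? T) xs)
filter-∈?-suc b T [] = refl
filter-∈?-suc b T (x ∷ xs) with x ∈? T
... | yes _ = cong (Fin.suc x ∷_) (filter-∈?-suc b T xs)
... | no _ = filter-∈?-suc b T xs

elems-∷ : ∀ {m} b (T : Subset m) →
  elems (b Vec.∷ T) ≡ map (suc ∘ toℕ) (filter (_∈? b Vec.∷ T) (Fin.zero ∷ map Fin.suc (allFin m)))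
elems-∷ b T = cong (λ fs → map (suc ∘ toℕ) (filter (_∈? b Vec.∷ T) (Fin.zero ∷ fs)))
  (sym (List.map-tabulate id Fin.suc))

map-suc-elems : ∀ {m} b (T : Subset m) →
  map (suc ∘ toℕ) (filter (_∈? b Vec.∷ T) (map Fin.suc (allFin m))) ≡ map suc (elems T)
map-suc-elems {m} b T = begin
  map (suc ∘ toℕ) (filter (_∈? b Vec.∷ T) (map Fin.suc (allFin m)))
    ≡⟨ cong (map (suc ∘ toℕ)) (filter-∈?-suc b T (allFin m)) ⟩
  map (suc ∘ toℕ) (map Fin.suc inT)      ≡⟨ List.map-∘ inT ⟨
  map (suc ∘ suc ∘ toℕ) inT              ≡⟨ List.map-∘ inT ⟩
  map suc (elems T)                      ∎
  where
  open ≡-Reasoning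
  inT = filter (_∈? T) (allFin m)

elems-inside : ∀ {m} (T : Subset m) → elems (inside Vec.∷ T) ≡ 1 ∷ map suc (elems T)
elems-inside T = trans (elems-∷ inside T) (cong (1 ∷_) (map-suc-elems inside T))

elems-outside : ∀ {m} (T : Subset m) → elems (outside Vec.∷ T) ≡ map suc (elems T)
elems-outside T = trans (elems-∷ outside T) (map-suc-elems outside T)

N-inside : ∀ {m} (T : Subset m) → N (suc (suc m)) (inside Vec.∷ T) ≡ 1 ∷ map suc (N (suc m) T)
N-inside {m} T = begin
  multi 1 0 (elems (inside Vec.∷ T)) (suc (suc m))  ≡⟨ cong (λ es → multi 1 0 es (2 + m)) (elems-inside T) ⟩
  1 ∷ multi 2 1 (map suc (elems T)) (suc (suc m))   ≡⟨ cong (1 ∷_) (multi-shift 2 0 (elems T) (suc m)) ⟩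
  1 ∷ multi 2 0 (elems T) (suc m)                   ≡⟨ cong (1 ∷_) (multi-suc 1 0 (elems T) (suc m)) ⟩
  1 ∷ map suc (N (suc m) T)                         ∎
  where open ≡-Reasoning

N-outside : ∀ {m} (T : Subset m) → N (suc (suc m)) (outside Vec.∷ T) ≡ 1 ∷ N (suc m) T
N-outside {m} T = begin
  multi 1 0 (elems (outside Vec.∷ T)) (suc (suc m)) ≡⟨ cong (λ es → multi 1 0 es (2 + m)) (elems-outside T) ⟩
  multi 1 0 (map suc (elems T)) (suc (suc m))       ≡⟨ multi-0 1 (elems T) (suc m) ⟩
  1 ∷ N (suc m) T                                   ∎
  where open ≡-Reasoning

∷-Sorted : ∀ {x xs} → All (x ≤_) xs → Sorted xs → Sorted (x ∷ xs)
∷-Sorted [] _ = [-]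
∷-Sorted (x≤y ∷ _) ys↗ = x≤y ∷ ys↗

N-head : ∀ m (T : Subset m) → ∃ λ r → N (suc m) T ≡ 1 ∷ r
N-head zero Vec.[] = [] , refl
N-head (suc m) (inside Vec.∷ T) = _ , N-inside T
N-head (suc m) (outside Vec.∷ T) = _ , N-outside T

N-length : ∀ m (T : Subset m) → length (N (suc m) T) ≡ suc m
N-length zero Vec.[] = refl
N-length (suc m) (inside Vec.∷ T) =
  trans (cong length (N-inside T)) (cong suc (trans (List.length-map suc (N (suc m) T)) (N-length m T)))
N-length (suc m) (outside Vec.∷ T) = trans (cong length (N-outside T)) (cong suc (N-length m T))

N-positive : ∀ m (T : Subset m) → All (1 ≤_) (N (suc m) T)
N-positive zero Vec.[] = s≤s z≤n ∷ []
N-positive (suc m) (inside Vec.∷ T) =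
  subst (All (1 ≤_)) (sym (N-inside T)) (s≤s z≤n ∷ All-map-suc-positive (N (suc m) T))
N-positive (suc m) (outside Vec.∷ T) = subst (All (1 ≤_)) (sym (N-outside T)) (s≤s z≤n ∷ N-positive m T)

N-sorted : ∀ m (T : Subset m) → Sorted (N (suc m) T)
N-sorted zero Vec.[] = [-]
N-sorted (suc m) (inside Vec.∷ T) = subst Sorted (sym (N-inside T))
  (∷-Sorted (All-map-suc-positive (N (suc m) T)) (Linked.map⁺ (Linked.map s≤s (N-sorted m T))))
N-sorted (suc m) (outside Vec.∷ T) = subst Sorted (sym (N-outside T)) (∷-Sorted (N-positive m T) (N-sorted m T))

DescentsWithin-map-suc : ∀ ks vs → DescentsWithin (map suc ks) vs ⇔ DescentsWithin ks vs
DescentsWithin-map-suc ks vs = mk⇔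
  (λ descents → Linked.map (λ tie → tie ∘ cong suc)
                   (Linked.map⁻ (subst (Linked TieDescent) zip-map-suc descents)))
  (λ descents → subst (Linked TieDescent) (sym zip-map-suc)
                   (Linked.map⁺ (Linked.map (λ tie → tie ∘ ℕ.suc-injective) descents)))
  where
  zip-map-suc : zip (map suc ks) vs ≡ map (Product.map₁ suc) (zip ks vs)
  zip-map-suc = trans (cong (zip (map suc ks)) (sym (List.map-id vs))) (List.zip-map suc id ks vs)

⊆⇔DescentsWithin-inside-step : ∀ {m} {X Y : Subset m} {b β w₁ w₂ ws} → (∃ λ r → β ≡ 1 ∷ r) →
  X ⊆ Y ⇔ DescentsWithin β (w₂ ∷ ws) →
  outside Vec.∷ X ⊆ b Vec.∷ Y ⇔ DescentsWithin (1 ∷ map suc β) (w₁ ∷ w₂ ∷ ws)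
⊆⇔DescentsWithin-inside-step {w₂ = w₂} {ws} (r , refl) X⊆Y⇔ = mk⇔
  (λ ⊆ → (λ ()) ∷ Equivalence.from map-suc (Equivalence.to X⊆Y⇔ (drop-∷-⊆ ⊆)))
  (λ { (_ ∷ descents) → out⊆ (Equivalence.from X⊆Y⇔ (Equivalence.to map-suc descents)) })
  where map-suc = DescentsWithin-map-suc (1 ∷ r) (w₂ ∷ ws)

⊆⇔DescentsWithin-outside-step : ∀ {m} {X Y : Subset m} {β w₁ w₂ ws} → (∃ λ r → β ≡ 1 ∷ r) →
  X ⊆ Y ⇔ DescentsWithin β (w₂ ∷ ws) →
  inside Vec.∷ X ⊆ isYes (w₂ ℕ.<? w₁) Vec.∷ Y ⇔ DescentsWithin (1 ∷ β) (w₁ ∷ w₂ ∷ ws)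
⊆⇔DescentsWithin-outside-step {X = X} {Y} {w₁ = w₁} {w₂} (r , refl) X⊆Y⇔ = mk⇔
  (λ ⊆ → (λ _ → descent (⊆ Vec.here)) ∷ Equivalence.to X⊆Y⇔ (drop-∷-⊆ ⊆))
  (λ { (tie ∷ descents) → subst (λ b → inside Vec.∷ X ⊆ b Vec.∷ Y)
         (sym (Equivalence.to T-≡ (fromWitness (tie refl)))) (in⊆in (Equivalence.from X⊆Y⇔ descents)) })
  where
  head-inside : ∀ {b} → (b Vec.∷ Y) Vec.[ Fin.zero ]= inside → b ≡ inside
  head-inside Vec.here = refl
  descent : (isYes (w₂ ℕ.<? w₁) Vec.∷ Y) Vec.[ Fin.zero ]= inside → w₂ < w₁
  descent = toWitness ∘ Equivalence.from T-≡ ∘ head-inside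

∁⊆D⇔DescentsWithin-N : ∀ m (T : Subset m) {w} → length w ≡ suc m →
                       ∁ T ⊆ D m w ⇔ DescentsWithin (N (suc m) T) w
∁⊆D⇔DescentsWithin-N zero Vec.[] {_ ∷ []} _ = mk⇔ (λ _ → [-]) (λ _ ())
∁⊆D⇔DescentsWithin-N (suc m) T {[]} ()
∁⊆D⇔DescentsWithin-N (suc m) T {_ ∷ []} ()
∁⊆D⇔DescentsWithin-N (suc m) (inside Vec.∷ T) {w@(_ ∷ w′@(_ ∷ _))} |w|≡ =
  subst (λ β → ∁ (inside Vec.∷ T) ⊆ D (suc m) w ⇔ DescentsWithin β w) (sym (N-inside T))
    (⊆⇔DescentsWithin-inside-step (N-head m T) (∁⊆D⇔DescentsWithin-N m T {w′} (ℕ.suc-injective |w|≡)))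
∁⊆D⇔DescentsWithin-N (suc m) (outside Vec.∷ T) {w@(_ ∷ w′@(_ ∷ _))} |w|≡ =
  subst (λ β → ∁ (outside Vec.∷ T) ⊆ D (suc m) w ⇔ DescentsWithin β w) (sym (N-outside T))
    (⊆⇔DescentsWithin-outside-step (N-head m T) (∁⊆D⇔DescentsWithin-N m T {w′} (ℕ.suc-injective |w|≡)))

module Standardization {n β} (β↗ : Sorted β) (|β|≡n : length β ≡ n) where

  ι : List ℕ
  ι = letters n

  -- u_{w_j} = β_j for all j, i.e. u = β ∘ w⁻¹.
  Matches : List ℕ → List ℕ → Set
  Matches u w = zip β w ↭ zip u ι

  toPerm : List ℕ → List ℕ
  toPerm u = reorder u ι

  toWord : List ℕ → List ℕ
  toWord w = reorder w β

  private
    |ι|≡n = letters-length n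

    length-↭β : ∀ {u} → u ↭ β → length u ≡ n
    length-↭β u↭β = trans (↭.↭-length u↭β) |β|≡n

    length-↭ι : ∀ {w} → w ↭ ι → length w ≡ n
    length-↭ι w↭ι = trans (↭.↭-length w↭ι) |ι|≡n

    zip-toPerm : ∀ {u} → u ↭ β → zip β (toPerm u) ≡ sortₗ (zip u ι)
    zip-toPerm u↭β = zip-reorder (trans (length-↭β u↭β) (sym |ι|≡n)) u↭β β↗

  toPerm-↭ : ∀ {u} → u ↭ β → toPerm u ↭ ι
  toPerm-↭ u↭β = reorder-↭ (trans (length-↭β u↭β) (sym |ι|≡n))

  toWord-↭ : ∀ {w} → w ↭ ι → toWord w ↭ β
  toWord-↭ w↭ι = reorder-↭ (trans (length-↭ι w↭ι) (sym |β|≡n))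

  toPerm-matches : ∀ {u} → u ↭ β → Matches u (toPerm u)
  toPerm-matches u↭β = ↭-trans (↭-reflexive (zip-toPerm u↭β)) (sortₗ-↭ _)

  toPerm-descents : ∀ {u} → u ↭ β → DescentsWithin β (toPerm u)
  toPerm-descents u↭β = Sortedₗ⇒DescentsWithin (subst Sortedₗ (sym (zip-toPerm u↭β)) (sortₗ-↗ _))
    (Unique-resp-↭ (↭⇒↭ₛ (↭-sym (toPerm-↭ u↭β))) (letters-unique n))

  toWord-matches : ∀ {w} → w ↭ ι → Matches (toWord w) w
  toWord-matches w↭ι = ↭-sym (zip-↭-swap (↭-trans
    (↭-reflexive (zip-reorder (trans (length-↭ι w↭ι) (sym |β|≡n)) w↭ι (letters-sorted n))) (sortₗ-↭ _)))

  Matches-injectiveˡ : ∀ {u u′ w} → u ↭ β → u′ ↭ β → Matches u w → Matches u′ w → u ≡ u′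
  Matches-injectiveˡ u↭β u′↭β matches matches′ =
    zip-↭-injectiveʳ (trans |ι|≡n (sym (length-↭β u↭β))) (trans |ι|≡n (sym (length-↭β u′↭β)))
      ι-keyed ι-keyed (zip-↭-swap (↭-trans (↭-sym matches) matches′))
    where
    ι-keyed : ∀ {vs} → Sortedₗ (zip ι vs)
    ι-keyed = Linked.map <⇒≤ₗ (Linked-zipˡ (letters-strict n))

  Matches-injectiveʳ : ∀ {u w w′} → w ↭ ι → w′ ↭ ι → DescentsWithin β w → DescentsWithin β w′ →
                       Matches u w → Matches u w′ → w ≡ w′
  Matches-injectiveʳ w↭ι w′↭ι descents descents′ matches matches′ =
    zip-↭-injectiveʳ (trans |β|≡n (sym (length-↭ι w↭ι))) (trans |β|≡n (sym (length-↭ι w′↭ι)))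
      (DescentsWithin⇒Sortedₗ β↗ descents) (DescentsWithin⇒Sortedₗ β↗ descents′)
      (↭-trans matches (↭-sym matches′))

  Cut-matches : ∀ {u w} → u ↭ β → w ↭ ι → DescentsWithin β w → Matches u w →
                ∀ {i} → i ≤ n → Cut i u ⇔ Cut i w
  Cut-matches {u} {w} u↭β w↭ι descents matches {i} i≤n = mk⇔ to from
    where
    |β|≡|w| = trans |β|≡n (sym (length-↭ι w↭ι))
    |u|≡|ι| = trans (length-↭β u↭β) (sym |ι|≡n)
    to : Cut i u → Cut i w
    to cut-u = ≪-resp-↭ (↭-sym (proj₁ blocks)) (↭-sym (proj₂ blocks))
                 (Cut-strict i (Linked.Linked⇒AllPairs ℕ.<-trans (letters-strict n)))
      where
      split = Cut-↭-sorted i (subst (i ≤_) (sym (length-↭β u↭β)) i≤n) cut-u u↭β β↗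
      blocks = Cut-↭-zip i |β|≡|w| |u|≡|ι| matches cut-u (↭-sym (proj₁ split)) (↭-sym (proj₂ split))
    from : Cut i w → Cut i u
    from cut-w = ≪-resp-↭ (↭-sym (proj₁ blocks)) (↭-sym (proj₂ blocks))
                   (Cut-keys i β↗ descents |β|≡|w| cut-w)
      where
      split = Cut-↭-sorted i (subst (i ≤_) (sym (length-↭ι w↭ι)) i≤n) cut-w w↭ι (letters-sorted n)
      blocks = Cut-↭-zip i (sym |u|≡|ι|) (sym |β|≡|w|) (zip-↭-swap (↭-sym matches)) cut-w
                 (↭-sym (proj₁ split)) (↭-sym (proj₂ split))

module _ (m : ℕ) (T : Subset m) where

  open Standardization (N-sorted m T) (N-length m T)

  private
    ∁T⊆D⇔ : ∀ {w} → w ↭ ι → ∁ T ⊆ D m w ⇔ DescentsWithin (N (suc m) T) w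
    ∁T⊆D⇔ w↭ι = ∁⊆D⇔DescentsWithin-N m T (trans (↭.↭-length w↭ι) (letters-length (suc m)))

  C-toPerm : ∀ {u} → u ↭ N (suc m) T → C m (toPerm u) ≡ C m u
  C-toPerm u↭β =
    sym (C-cong (Cut-matches u↭β (toPerm-↭ u↭β) (toPerm-descents u↭β) (toPerm-matches u↭β)))

  ∁⊆D-toPerm : ∀ {u} → u ↭ N (suc m) T → ∁ T ⊆ D m (toPerm u)
  ∁⊆D-toPerm u↭β = Equivalence.from (∁T⊆D⇔ (toPerm-↭ u↭β)) (toPerm-descents u↭β)

  toWord-toPerm : ∀ {u} → u ↭ N (suc m) T → toWord (toPerm u) ≡ u
  toWord-toPerm u↭β = Matches-injectiveˡ (toWord-↭ w↭ι) u↭β (toWord-matches w↭ι) (toPerm-matches u↭β)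
    where w↭ι = toPerm-↭ u↭β

  C-toWord : ∀ {w} → w ↭ ι → ∁ T ⊆ D m w → C m (toWord w) ≡ C m w
  C-toWord w↭ι ∁T⊆D =
    C-cong (Cut-matches (toWord-↭ w↭ι) w↭ι (Equivalence.to (∁T⊆D⇔ w↭ι) ∁T⊆D) (toWord-matches w↭ι))

  toPerm-toWord : ∀ {w} → w ↭ ι → ∁ T ⊆ D m w → toPerm (toWord w) ≡ w
  toPerm-toWord w↭ι ∁T⊆D = Matches-injectiveʳ (toPerm-↭ u↭β) w↭ι (toPerm-descents u↭β)
    (Equivalence.to (∁T⊆D⇔ w↭ι) ∁T⊆D) (toPerm-matches u↭β) (toWord-matches w↭ι)
    where u↭β = toWord-↭ w↭ι

  count-C-N≡count-C-D : ∀ S →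
    count (λ u → C m u ≟ₛ S) (𝔖 (N (suc m) T))
      ≡ count (λ w → (C m w ≟ₛ S) ×-dec (∁ T ⊆? D m w)) (𝔖 (perm (suc m)))
  count-C-N≡count-C-D S = count′-bijection (List.≡-dec ℕ._≟_) (λ u → C m u ≟ₛ S)
    (λ w → (C m w ≟ₛ S) ×-dec (∁ T ⊆? D m w)) toPerm toWord
    (𝔖-unique (N (suc m) T)) (𝔖-unique ι)
    (λ u∈𝔖 C≡S → let u↭β = ∈-𝔖⁻ u∈𝔖 in
      ∈-𝔖⁺ (All-map-suc-positive (upTo (suc m))) (toPerm-↭ u↭β) ,
      (trans (C-toPerm u↭β) C≡S , ∁⊆D-toPerm u↭β) , toWord-toPerm u↭β)
    (λ w∈𝔖 (C≡S , ∁T⊆D) → let w↭ι = ∈-𝔖⁻ w∈𝔖 in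
      ∈-𝔖⁺ (N-positive m T) (toWord-↭ w↭ι) , trans (C-toWord w↭ι ∁T⊆D) C≡S , toPerm-toWord w↭ι ∁T⊆D)

proposition2p1 : (m : ℕ) (S T : Subset m) →
    (count (λ w → C m w ≟ₛ S) (𝔖 (N (suc m) T)) ≡ ΓM m (∁ S) (∁ T))
    × (ΓM m (∁ S) (∁ T) ≡ sum (map (Γ m (∁ S)) (filter (∁ T ⊆?_) (allSubsets m))))
    × (sum (map (Γ m (∁ S)) (filter (∁ T ⊆?_) (allSubsets m)))
        ≡ count (λ w → (C m w ≟ₛ S) ×-dec (∁ T ⊆? D m w)) (𝔖 (perm (suc m))))
proposition2p1 m S T =
  trans (count-C-N≡count-C-D m T S) (sym (trans ΓM≡sum ∑≡count)) , ΓM≡sum , ∑≡count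
  where
  ΓM≡sum = ΓM≡sum-Γ-⊇ m (∁ S) (∁ T)
  ∑≡count = sum-Γ-⊇≡count m S (∁ T)
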